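{- For every GCL command $c$ and variable $pc$ that does not occur in $c$, we have $\mathrm{ghost}(pc,\mathrm{add}^{pc}(c))$, and $\mathrm{erase}(pc,\mathrm{add}^{pc}(c))\simeq c$.
   Context: GCL commands: $c::=\mathsf{skip}^n\mid x:=^n e\mid\mathsf{havoc}^n x\mid c;c\mid\mathsf{if}^n gcs\,\mathsf{fi}\mid\mathsf{do}^n gcs\,\mathsf{od}$, labels $n\in\mathbb{Z}$, $gcs$ a nonempty list of guarded commands $e\to c$ (boolean guards built from primitive boolean expressions $bprim$ by $\wedge,\vee,\neg$), $\mathrm{enab}(gcs)$ the disjunction of the guards; variables are integer-valued, stores are total maps $\mathit{Var}\to\mathbb{Z}$; commands are well typed and each $\mathsf{if}\,gcs\,\mathsf{fi}$ has $\mathrm{enab}(gcs)$ valid. $!n$ abbreviates the assignment $pc:=^0 n$ ($n$ a literal). $\mathrm{add}^{pc}$: $\mathrm{add}^{pc}(\mathsf{skip}^n)=!n;\mathsf{skip}^n$; $\mathrm{add}^{pc}(x:=^n e)=!n;x:=^n e$; $\mathrm{add}^{pc}(\mathsf{havoc}^n x)=!n;\mathsf{havoc}^n x$; $\mathrm{add}^{pc}(c;d)=\mathrm{add}^{pc}(c);\mathrm{add}^{pc}(d)$; $\mathrm{add}^{pc}(\mathsf{if}^n gcs\,\mathsf{fi})=!n;\mathsf{if}^n\,\mathrm{add}^{pc}_0(gcs)\,\mathsf{fi}$, where $\mathrm{add}^{pc}_0$ replaces each $e\to c$ by $e\to\mathrm{add}^{pc}(c)$; $\mathrm{add}^{pc}(\mathsf{do}^n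 gcs\,\mathsf{od})=!n;\mathsf{do}^n\,\mathrm{add}^{pc}_1(n,gcs)\,\mathsf{od}$, where $\mathrm{add}^{pc}_1(n,\cdot)$ replaces each $e\to c$ by $e\to\mathrm{add}^{pc}(c);!n$. $\mathrm{ghost}(x,c)$: $x$ occurs in $c$ only as target of assignments to $x$ and of $\mathsf{havoc}\,x$. $\mathrm{erase}(x,c)$: $c$ with every assignment to $x$ and every $\mathsf{havoc}\,x$ replaced by $\mathsf{skip}$. Command equivalence $c\simeq d$: $\mathrm{Hyp}\vdash\lfloor c\rfloor=\lfloor d\rfloor$, where: KAT axioms are those of an idempotent semiring $(\mathbb{K},+,;,0,1)$ with a Boolean subalgebra $\mathbb{B}$ of tests ($1$ true, $;$ conjunction, $+$ disjunction, $\neg$ complement) and $1+x;x^*=x^*$, $1+x^*;x=x^*$, $y+x;z\le z\Rightarrow x^*;y\le z$, $y+z;x\le z\Rightarrow y;x^*\le z$ ($x\le y$ iff $x+y=y$); KAT expressions $E::=\underline{bprim}\mid\underline{x:=e}\mid\underline{\mathsf{havoc}\,x}\mid E+E\mid E;E\mid E^*\mid\neg E\mid1\mid0$; translation $\lfloor bprim\rfloor=\underline{bprim}$, $\lfloor\neg e\rfloor=\neg\lfloor e\rfloor$, $\lfloor e\wedge e'\rfloor=\lfloor e\rfloor;\lfloor e'\rfloor$, $\lfloor e\vee e'\rfloor=\lfloor e\rfloor+\lfloor e'\rfloor$, $\lfloor\mathsf{skip}\rfloor=1$, $\lfloor x:=e\rfloor=\underline{x:=e}$, $\lfloor\mathsf{havoc}\,x\rfloor=\underline{\mathsf{havoc}\,x}$,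 $\lfloor c;d\rfloor=\lfloor c\rfloor;\lfloor d\rfloor$, $\lfloor\mathsf{if}\,gcs\,\mathsf{fi}\rfloor=\lfloor gcs\rfloor$, $\lfloor\mathsf{do}\,gcs\,\mathsf{od}\rfloor=\lfloor gcs\rfloor^*;\neg\lfloor\mathrm{enab}(gcs)\rfloor$, $\lfloor gcs\rfloor=\sum_{e\to c\in gcs}\lfloor e\rfloor;\lfloor c\rfloor$; $\mathrm{Hyp}$ consists of (a) $\lfloor e\rfloor=0$ for every boolean $e$ with $e\Rightarrow\mathit{false}$ valid, (b) $\lfloor e_0\rfloor;\underline{x:=e};\neg\lfloor e_1\rfloor=0$ whenever $e_0\Rightarrow e_1[x:=e]$ is valid, (c) $\lfloor e_0\rfloor;\underline{\mathsf{havoc}\,x};\neg\lfloor e_1\rfloor=0$ whenever $e_0\Rightarrow\forall x.e_1$ is valid; $H\vdash E_0=E_1$ means provable by equational and propositional reasoning from $H$ and the KAT axioms. -}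

module Defs where

open import Data.Nat using (ℕ)
import Data.Nat as ℕ
open import Data.Integer as ℤ using (ℤ)
open import Data.Bool using (Bool; true; false; if_then_else_; _∧_; _∨_; not)
open import Data.Unit using (⊤)
open import Data.Product using (_×_)
open import Relation.Nullary using (¬_; does)
open import Relation.Binary.PropositionalEquality using (_≡_)

Var : Set
Var = ℕ

Store : Set
Store = Var → ℤ

update : Store → Var → ℤ → Store
update s x v y = if does (x ℕ.≟ y) then v else s y

data AExp : Set where
  lit  : ℤ → AExp
  var  : Var → AExp
  plus minus times : AExp → AExp → AExp

evalA : AExp → Store → ℤ
evalA (lit i)       s = i
evalA (var x)       s = s x
evalA (plus a b)    s = evalA a s ℤ.+ evalA b s
evalA (minus a b)   s = evalA a s ℤ.- evalA b s
evalA (times a b)   s = evalA a s ℤ.* evalA b s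

substA : AExp → Var → AExp → AExp
substA (lit i)     x e = lit i
substA (var y)     x e = if does (x ℕ.≟ y) then e else var y
substA (plus a b)  x e = plus (substA a x e) (substA b x e)
substA (minus a b) x e = minus (substA a x e) (substA b x e)
substA (times a b) x e = times (substA a x e) (substA b x e)

NotInA : Var → AExp → Set
NotInA x (lit i)     = ⊤
NotInA x (var y)     = ¬ (x ≡ y)
NotInA x (plus a b)  = NotInA x a × NotInA x b
NotInA x (minus a b) = NotInA x a × NotInA x b
NotInA x (times a b) = NotInA x a × NotInA x b

data BPrim : Set where
  btrue bfalse : BPrim
  eq le lt     : AExp → AExp → BPrim

data BExp : Set where
  prim : BPrim → BExp
  and  : BExp → BExp → BExp
  or   : BExp → BExp → BExp
  neg  : BExp → BExp

evalP : BPrim → Store → Bool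
evalP btrue    s = true
evalP bfalse   s = false
evalP (eq a b) s = does (evalA a s ℤ.≟ evalA b s)
evalP (le a b) s = evalA a s ℤ.≤ᵇ evalA b s
evalP (lt a b) s = (evalA a s ℤ.+ ℤ.1ℤ) ℤ.≤ᵇ evalA b s

evalB : BExp → Store → Bool
evalB (prim p)  s = evalP p s
evalB (and b c) s = evalB b s ∧ evalB c s
evalB (or b c)  s = evalB b s ∨ evalB c s
evalB (neg b)   s = not (evalB b s)

substP : BPrim → Var → AExp → BPrim
substP btrue    x e = btrue
substP bfalse   x e = bfalse
substP (eq a b) x e = eq (substA a x e) (substA b x e)
substP (le a b) x e = le (substA a x e) (substA b x e)
substP (lt a b) x e = lt (substA a x e) (substA b x e)

substB : BExp → Var → AExp → BExp
substB (prim p)  x e = prim (substP p x e)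
substB (and b c) x e = and (substB b x e) (substB c x e)
substB (or b c)  x e = or (substB b x e) (substB c x e)
substB (neg b)   x e = neg (substB b x e)

NotInP : Var → BPrim → Set
NotInP x btrue    = ⊤
NotInP x bfalse   = ⊤
NotInP x (eq a b) = NotInA x a × NotInA x b
NotInP x (le a b) = NotInA x a × NotInA x b
NotInP x (lt a b) = NotInA x a × NotInA x b

NotInB : Var → BExp → Set
NotInB x (prim p)  = NotInP x p
NotInB x (and b c) = NotInB x b × NotInB x c
NotInB x (or b c)  = NotInB x b × NotInB x c
NotInB x (neg b)   = NotInB x b

Valid : BExp → Set
Valid b = (s : Store) → evalB b s ≡ true

Label : Set
Label = ℤ

mutual
  data Cmd : Set where
    skip   : Label → Cmd
    assign : Label → Var → AExp → Cmd
    havoc  : Label → Var → Cmd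
    _︔_    : Cmd → Cmd → Cmd
    ifc    : Label → GCs → Cmd
    doc    : Label → GCs → Cmd

  data GCs : Set where
    [_⇒_]    : BExp → Cmd → GCs
    _⇒_∷_    : BExp → Cmd → GCs → GCs

infixr 5 _︔_

enab : GCs → BExp
enab [ e ⇒ c ]     = e
enab (e ⇒ c ∷ gs) = or e (enab gs)

-- standing assumption: every if gcs fi has enab(gcs) valid
mutual
  WellFormed : Cmd → Set
  WellFormed (skip n)       = ⊤
  WellFormed (assign n x e) = ⊤
  WellFormed (havoc n x)    = ⊤
  WellFormed (c ︔ d)        = WellFormed c × WellFormed d
  WellFormed (ifc n gs)     = Valid (enab gs) × WellFormedG gs
  WellFormed (doc n gs)     = WellFormedG gs

  WellFormedG : GCs → Set
  WellFormedG [ e ⇒ c ]     = WellFormed c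
  WellFormedG (e ⇒ c ∷ gs) = WellFormed c × WellFormedG gs

mutual
  NotIn : Var → Cmd → Set
  NotIn x (skip n)       = ⊤
  NotIn x (assign n y e) = ¬ (x ≡ y) × NotInA x e
  NotIn x (havoc n y)    = ¬ (x ≡ y)
  NotIn x (c ︔ d)        = NotIn x c × NotIn x d
  NotIn x (ifc n gs)     = NotInG x gs
  NotIn x (doc n gs)     = NotInG x gs

  NotInG : Var → GCs → Set
  NotInG x [ e ⇒ c ]     = NotInB x e × NotIn x c
  NotInG x (e ⇒ c ∷ gs) = NotInB x e × NotIn x c × NotInG x gs

mutual
  Ghost : Var → Cmd → Set
  Ghost x (skip n)       = ⊤
  Ghost x (assign n y e) = NotInA x e
  Ghost x (havoc n y)    = ⊤
  Ghost x (c ︔ d)        = Ghost x c × Ghost x d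
  Ghost x (ifc n gs)     = GhostG x gs
  Ghost x (doc n gs)     = GhostG x gs

  GhostG : Var → GCs → Set
  GhostG x [ e ⇒ c ]     = NotInB x e × Ghost x c
  GhostG x (e ⇒ c ∷ gs) = NotInB x e × Ghost x c × GhostG x gs

mutual
  erase : Var → Cmd → Cmd
  erase x (skip n)       = skip n
  erase x (assign n y e) = if does (x ℕ.≟ y) then skip n else assign n y e
  erase x (havoc n y)    = if does (x ℕ.≟ y) then skip n else havoc n y
  erase x (c ︔ d)        = erase x c ︔ erase x d
  erase x (ifc n gs)     = ifc n (eraseG x gs)
  erase x (doc n gs)     = doc n (eraseG x gs)

  eraseG : Var → GCs → GCs
  eraseG x [ e ⇒ c ]     = [ e ⇒ erase x c ]
  eraseG x (e ⇒ c ∷ gs) = e ⇒ erase x c ∷ eraseG x gs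

setpc : Var → ℤ → Cmd
setpc pc n = assign ℤ.0ℤ pc (lit n)

mutual
  addpc : Var → Cmd → Cmd
  addpc pc (skip n)       = setpc pc n ︔ skip n
  addpc pc (assign n x e) = setpc pc n ︔ assign n x e
  addpc pc (havoc n x)    = setpc pc n ︔ havoc n x
  addpc pc (c ︔ d)        = addpc pc c ︔ addpc pc d
  addpc pc (ifc n gs)     = setpc pc n ︔ ifc n (addpc₀ pc gs)
  addpc pc (doc n gs)     = setpc pc n ︔ doc n (addpc₁ pc n gs)

  addpc₀ : Var → GCs → GCs
  addpc₀ pc [ e ⇒ c ]     = [ e ⇒ addpc pc c ]
  addpc₀ pc (e ⇒ c ∷ gs) = e ⇒ addpc pc c ∷ addpc₀ pc gs

  addpc₁ : Var → ℤ → GCs → GCs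
  addpc₁ pc n [ e ⇒ c ]     = [ e ⇒ (addpc pc c ︔ setpc pc n) ]
  addpc₁ pc n (e ⇒ c ∷ gs) = e ⇒ (addpc pc c ︔ setpc pc n) ∷ addpc₁ pc n gs

data KExp : Set where
  kprim  : BPrim → KExp
  kasg   : Var → AExp → KExp
  khavoc : Var → KExp
  _⊕_    : KExp → KExp → KExp
  _⨾_    : KExp → KExp → KExp
  _⋆     : KExp → KExp
  ~_     : KExp → KExp
  𝟙 𝟘    : KExp

infixl 6 _⊕_
infixl 7 _⨾_
infix  8 _⋆
infix  9 ~_

data IsTest : KExp → Set where
  t-prim : ∀ p → IsTest (kprim p)
  t-one  : IsTest 𝟙
  t-zero : IsTest 𝟘
  t-neg  : ∀ {b} → IsTest b → IsTest (~ b)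
  t-plus : ∀ {b c} → IsTest b → IsTest c → IsTest (b ⊕ c)
  t-seq  : ∀ {b c} → IsTest b → IsTest c → IsTest (b ⨾ c)

⌊_⌋B : BExp → KExp
⌊ prim p ⌋B  = kprim p
⌊ neg e ⌋B   = ~ ⌊ e ⌋B
⌊ and e f ⌋B = ⌊ e ⌋B ⨾ ⌊ f ⌋B
⌊ or e f ⌋B  = ⌊ e ⌋B ⊕ ⌊ f ⌋B

mutual
  ⌊_⌋ : Cmd → KExp
  ⌊ skip n ⌋       = 𝟙
  ⌊ assign n x e ⌋ = kasg x e
  ⌊ havoc n x ⌋    = khavoc x
  ⌊ c ︔ d ⌋        = ⌊ c ⌋ ⨾ ⌊ d ⌋
  ⌊ ifc n gs ⌋     = ⌊ gs ⌋G
  ⌊ doc n gs ⌋     = (⌊ gs ⌋G ⋆) ⨾ (~ ⌊ enab gs ⌋B)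

  ⌊_⌋G : GCs → KExp
  ⌊ [ e ⇒ c ] ⌋G     = ⌊ e ⌋B ⨾ ⌊ c ⌋
  ⌊ e ⇒ c ∷ gs ⌋G   = ⌊ e ⌋B ⨾ ⌊ c ⌋ ⊕ ⌊ gs ⌋G

data Hyp : KExp → KExp → Set where
  hyp-false  : ∀ e → ((s : Store) → evalB e s ≡ false) → Hyp ⌊ e ⌋B 𝟘
  hyp-assign : ∀ e₀ x e e₁ →
               ((s : Store) → evalB e₀ s ≡ true → evalB (substB e₁ x e) s ≡ true) →
               Hyp (⌊ e₀ ⌋B ⨾ kasg x e ⨾ ~ ⌊ e₁ ⌋B) 𝟘
  hyp-havoc  : ∀ e₀ x e₁ →
               ((s : Store) → evalB e₀ s ≡ true → (v : ℤ) → evalB e₁ (update s x v) ≡ true) →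
               Hyp (⌊ e₀ ⌋B ⨾ khavoc x ⨾ ~ ⌊ e₁ ⌋B) 𝟘

data _⊢_≈_ (H : KExp → KExp → Set) : KExp → KExp → Set where
  hyp     : ∀ {x y} → H x y → H ⊢ x ≈ y
  refl    : ∀ {x} → H ⊢ x ≈ x
  sym     : ∀ {x y} → H ⊢ x ≈ y → H ⊢ y ≈ x
  trans   : ∀ {x y z} → H ⊢ x ≈ y → H ⊢ y ≈ z → H ⊢ x ≈ z
  cong-⊕  : ∀ {x x' y y'} → H ⊢ x ≈ x' → H ⊢ y ≈ y' → H ⊢ x ⊕ y ≈ x' ⊕ y'
  cong-⨾  : ∀ {x x' y y'} → H ⊢ x ≈ x' → H ⊢ y ≈ y' → H ⊢ x ⨾ y ≈ x' ⨾ y'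
  cong-⋆  : ∀ {x x'} → H ⊢ x ≈ x' → H ⊢ x ⋆ ≈ x' ⋆
  cong-~  : ∀ {x x'} → H ⊢ x ≈ x' → H ⊢ ~ x ≈ ~ x'
  ⊕-assoc : ∀ x y z → H ⊢ (x ⊕ y) ⊕ z ≈ x ⊕ (y ⊕ z)
  ⊕-comm  : ∀ x y → H ⊢ x ⊕ y ≈ y ⊕ x
  ⊕-idem  : ∀ x → H ⊢ x ⊕ x ≈ x
  ⊕-zero  : ∀ x → H ⊢ x ⊕ 𝟘 ≈ x
  ⨾-assoc : ∀ x y z → H ⊢ (x ⨾ y) ⨾ z ≈ x ⨾ (y ⨾ z)
  ⨾-oneˡ  : ∀ x → H ⊢ 𝟙 ⨾ x ≈ x
  ⨾-oneʳ  : ∀ x → H ⊢ x ⨾ 𝟙 ≈ x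
  ⨾-zeroˡ : ∀ x → H ⊢ 𝟘 ⨾ x ≈ 𝟘
  ⨾-zeroʳ : ∀ x → H ⊢ x ⨾ 𝟘 ≈ 𝟘
  distribˡ : ∀ x y z → H ⊢ x ⨾ (y ⊕ z) ≈ x ⨾ y ⊕ x ⨾ z
  distribʳ : ∀ x y z → H ⊢ (x ⊕ y) ⨾ z ≈ x ⨾ z ⊕ y ⨾ z
  test-⨾-comm  : ∀ {b c} → IsTest b → IsTest c → H ⊢ b ⨾ c ≈ c ⨾ b
  test-⊕-distrib : ∀ {b c d} → IsTest b → IsTest c → IsTest d →
                   H ⊢ b ⊕ c ⨾ d ≈ (b ⊕ c) ⨾ (b ⊕ d)
  test-compl-⊕ : ∀ {b} → IsTest b → H ⊢ b ⊕ ~ b ≈ 𝟙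
  test-compl-⨾ : ∀ {b} → IsTest b → H ⊢ b ⨾ ~ b ≈ 𝟘
  star-unfoldˡ : ∀ x → H ⊢ 𝟙 ⊕ x ⨾ (x ⋆) ≈ x ⋆
  star-unfoldʳ : ∀ x → H ⊢ 𝟙 ⊕ (x ⋆) ⨾ x ≈ x ⋆
  -- y + x;z ≤ z ⇒ x*;y ≤ z      (a ≤ b  iff  a + b = b)
  star-indˡ : ∀ x y z → H ⊢ (y ⊕ x ⨾ z) ⊕ z ≈ z → H ⊢ (x ⋆) ⨾ y ⊕ z ≈ z
  star-indʳ : ∀ x y z → H ⊢ (y ⊕ z ⨾ x) ⊕ z ≈ z → H ⊢ y ⨾ (x ⋆) ⊕ z ≈ z

infix 4 _⊢_≈_

_≃_ : Cmd → Cmd → Set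
c ≃ d = Hyp ⊢ ⌊ c ⌋ ≈ ⌊ d ⌋

infix 4 _≃_

-- add^pc only inserts assignments pc := n with literal right-hand sides, so pc never
-- occurs in an expression of add^pc(c). Erasing pc turns each inserted assignment into
-- skip, whose translation 1 is the unit of ;, while guards (hence enab) are untouched;
-- so the translation of the erased command reduces to that of c by congruence.
module Submission where

open import Defs
open import Data.Product using (_×_; _,_)
open import Data.Unit using (tt)
import Data.Nat as ℕ
import Data.Integer as ℤ
open import Relation.Nullary.Decidable using (dec-true; dec-false)
open import Relation.Binary.PropositionalEquality as ≡ using (_≡_; _≢_)

erase-setpc : ∀ pc n → erase pc (setpc pc n) ≡ skip ℤ.0ℤ
erase-setpc pc n rewrite dec-true (pc ℕ.≟ pc) ≡.refl = ≡.refl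

erase-assign-≢ : ∀ {x y} n e → x ≢ y → erase x (assign n y e) ≡ assign n y e
erase-assign-≢ {x} {y} n e x≢y rewrite dec-false (x ℕ.≟ y) x≢y = ≡.refl

erase-havoc-≢ : ∀ {x y} n → x ≢ y → erase x (havoc n y) ≡ havoc n y
erase-havoc-≢ {x} {y} n x≢y rewrite dec-false (x ℕ.≟ y) x≢y = ≡.refl

enab-eraseG : ∀ x gs → enab (eraseG x gs) ≡ enab gs
enab-eraseG x [ e ⇒ c ]     = ≡.refl
enab-eraseG x (e ⇒ c ∷ gs) = ≡.cong (or e) (enab-eraseG x gs)

enab-addpc₁ : ∀ pc n gs → enab (addpc₁ pc n gs) ≡ enab gs
enab-addpc₁ pc n [ e ⇒ c ]     = ≡.refl
enab-addpc₁ pc n (e ⇒ c ∷ gs) = ≡.cong (or e) (enab-addpc₁ pc n gs)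

≡⇒⊢≈ : ∀ {H x y} → x ≡ y → H ⊢ x ≈ y
≡⇒⊢≈ ≡.refl = refl

erased-setpc-⨾ : ∀ pc n {x y} → Hyp ⊢ x ≈ y → Hyp ⊢ ⌊ erase pc (setpc pc n) ⌋ ⨾ x ≈ y
erased-setpc-⨾ pc n x≈y rewrite erase-setpc pc n = trans (cong-⨾ refl x≈y) (⨾-oneˡ _)

⨾-erased-setpc : ∀ pc n {x y} → Hyp ⊢ x ≈ y → Hyp ⊢ x ⨾ ⌊ erase pc (setpc pc n) ⌋ ≈ y
⨾-erased-setpc pc n x≈y rewrite erase-setpc pc n = trans (cong-⨾ x≈y refl) (⨾-oneʳ _)

mutual
  ghost-addpc : ∀ pc c → NotIn pc c → Ghost pc (addpc pc c)
  ghost-addpc pc (skip n)       _            = tt , tt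
  ghost-addpc pc (assign n x e) (_ , pc∉e)   = tt , pc∉e
  ghost-addpc pc (havoc n x)    _            = tt , tt
  ghost-addpc pc (c ︔ d)        (pc∉c , pc∉d) = ghost-addpc pc c pc∉c , ghost-addpc pc d pc∉d
  ghost-addpc pc (ifc n gs)     pc∉gs        = tt , ghost-addpc₀ pc gs pc∉gs
  ghost-addpc pc (doc n gs)     pc∉gs        = tt , ghost-addpc₁ pc n gs pc∉gs

  ghost-addpc₀ : ∀ pc gs → NotInG pc gs → GhostG pc (addpc₀ pc gs)
  ghost-addpc₀ pc [ e ⇒ c ]     (pc∉e , pc∉c) = pc∉e , ghost-addpc pc c pc∉c
  ghost-addpc₀ pc (e ⇒ c ∷ gs) (pc∉e , pc∉c , pc∉gs) =
    pc∉e , ghost-addpc pc c pc∉c , ghost-addpc₀ pc gs pc∉gs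

  ghost-addpc₁ : ∀ pc n gs → NotInG pc gs → GhostG pc (addpc₁ pc n gs)
  ghost-addpc₁ pc n [ e ⇒ c ]     (pc∉e , pc∉c) = pc∉e , ghost-addpc pc c pc∉c , tt
  ghost-addpc₁ pc n (e ⇒ c ∷ gs) (pc∉e , pc∉c , pc∉gs) =
    pc∉e , (ghost-addpc pc c pc∉c , tt) , ghost-addpc₁ pc n gs pc∉gs

mutual
  erase-addpc : ∀ pc c → NotIn pc c → erase pc (addpc pc c) ≃ c
  erase-addpc pc (skip n)       _ = erased-setpc-⨾ pc n refl
  erase-addpc pc (assign n x e) (pc≢x , _) =
    erased-setpc-⨾ pc n (≡⇒⊢≈ (≡.cong ⌊_⌋ (erase-assign-≢ n e pc≢x)))
  erase-addpc pc (havoc n x)    pc≢x =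
    erased-setpc-⨾ pc n (≡⇒⊢≈ (≡.cong ⌊_⌋ (erase-havoc-≢ n pc≢x)))
  erase-addpc pc (c ︔ d) (pc∉c , pc∉d) = cong-⨾ (erase-addpc pc c pc∉c) (erase-addpc pc d pc∉d)
  erase-addpc pc (ifc n gs) pc∉gs = erased-setpc-⨾ pc n (erase-addpc₀ pc gs pc∉gs)
  erase-addpc pc (doc n gs) pc∉gs =
    erased-setpc-⨾ pc n (cong-⨾ (cong-⋆ (erase-addpc₁ pc n gs pc∉gs)) (cong-~ (≡⇒⊢≈ enab≡)))
    where
    enab≡ : ⌊ enab (eraseG pc (addpc₁ pc n gs)) ⌋B ≡ ⌊ enab gs ⌋B
    enab≡ = ≡.cong ⌊_⌋B (≡.trans (enab-eraseG pc (addpc₁ pc n gs)) (enab-addpc₁ pc n gs))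

  erase-addpc₀ : ∀ pc gs → NotInG pc gs → Hyp ⊢ ⌊ eraseG pc (addpc₀ pc gs) ⌋G ≈ ⌊ gs ⌋G
  erase-addpc₀ pc [ e ⇒ c ]     (_ , pc∉c) = cong-⨾ refl (erase-addpc pc c pc∉c)
  erase-addpc₀ pc (e ⇒ c ∷ gs) (_ , pc∉c , pc∉gs) =
    cong-⊕ (cong-⨾ refl (erase-addpc pc c pc∉c)) (erase-addpc₀ pc gs pc∉gs)

  erase-addpc₁ : ∀ pc n gs → NotInG pc gs → Hyp ⊢ ⌊ eraseG pc (addpc₁ pc n gs) ⌋G ≈ ⌊ gs ⌋G
  erase-addpc₁ pc n [ e ⇒ c ]     (_ , pc∉c) =
    cong-⨾ refl (⨾-erased-setpc pc n (erase-addpc pc c pc∉c))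
  erase-addpc₁ pc n (e ⇒ c ∷ gs) (_ , pc∉c , pc∉gs) =
    cong-⊕ (cong-⨾ refl (⨾-erased-setpc pc n (erase-addpc pc c pc∉c))) (erase-addpc₁ pc n gs pc∉gs)

-- Well-formedness (valid enab of each if) is not needed: erasure keeps every guard.
lemma5p9 : (c : Cmd) (pc : Var) → WellFormed c → NotIn pc c →
           Ghost pc (addpc pc c) × (erase pc (addpc pc c) ≃ c)
lemma5p9 c pc _ pc∉c = ghost-addpc pc c pc∉c , erase-addpc pc c pc∉c
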